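{- No fractional online algorithm achieves a competitive ratio better than $0.75$ for the unweighted fractional online stochastic matching problem (with independent, not necessarily identically distributed, arrivals).
   Context: Problem: offline vertex set $L$ (unweighted, i.e. all weights $1$); online vertices $v_1,\dots,v_n$ arrive in a fixed order, the type $t_j$ of $v_j$ (which specifies its set of offline neighbours) being drawn independently from a known distribution $D_j$. On arrival of $v_j$, after seeing $t_1,\dots,t_j$, a fractional online algorithm irrevocably chooses $x_{u,j}\ge0$ for $u\in L$, positive only for neighbours $u$ of $v_j$, with $\sum_u x_{u,j}\le1$; its value is $\sum_{u}\min(\sum_j x_{u,j},1)$. Its competitive ratio is the infimum over instances of the expected value divided by the expected size of a maximum matching of the realized graph.
   Formalization: The fractional online algorithms make only rational decisions $x_{u,j}$, and the probabilities of the distributions $D_j$ are taken in ℚ. -}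

module Defs where

open import Data.Bool using (Bool; true; false; _∧_; if_then_else_)
open import Data.Nat as ℕ using (ℕ; zero; suc; _⊔_)
open import Data.Fin using (Fin; zero; suc; toℕ)
import Data.Fin as Fin
open import Data.Fin.Subset using (Subset; _∉_)
open import Data.Maybe using (Maybe; just; nothing)
open import Data.List as List using (List; []; _∷_; concatMap; foldr; filter; allFin)
open import Data.Vec as Vec using (Vec; []; _∷_; lookup)
open import Data.Product using (_×_; _,_; proj₁; proj₂; Σ; ∃)
open import Data.Integer using (+_)
open import Data.Rational as ℚ using (ℚ; 0ℚ; 1ℚ; _+_; _*_; _≤_; _<_; _⊓_; _/_)
open import Relation.Nullary.Decidable using (isYes; does)
open import Relation.Nullary.Decidable.Core using (T?)
open import Relation.Binary.PropositionalEquality using (_≡_)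

∑ : ∀ {k} → (Fin k → ℚ) → ℚ
∑ {zero}  f = 0ℚ
∑ {suc k} f = f zero + ∑ (λ i → f (suc i))

sumℚ : List ℚ → ℚ
sumℚ = foldr _+_ 0ℚ

-- Offline vertices L = Fin m.  A type of an online vertex is its
-- set of offline neighbours, a Subset m.  A distribution over types is a
-- finite list of (probability , type) pairs (finitely many types exist).

Dist : ℕ → Set
Dist m = List (ℚ × Subset m)

Instance : ℕ → ℕ → Set
Instance m n = Vec (Dist m) n

ValidDist : ∀ {m} → Dist m → Set
ValidDist d = (∀ {p t} → (p , t) List.∈ d → 0ℚ ≤ p) × (sumℚ (List.map proj₁ d) ≡ 1ℚ)
  where import Data.List.Membership.Propositional as List

ValidInstance : ∀ {m n} → Instance m n → Set
ValidInstance {n = n} D = ∀ (j : Fin n) → ValidDist (lookup D j)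

-- Realisations (t_1 , … , t_n) together with their probabilities
-- (types drawn independently from D_1 , … , D_n).
outcomes : ∀ {m n} → Instance m n → List (ℚ × Vec (Subset m) n)
outcomes []       = (1ℚ , []) ∷ []
outcomes (d ∷ ds) =
  concatMap (λ { (p , t) → List.map (λ { (q , ts) → (p * q , t ∷ ts) }) (outcomes ds) }) d

𝔼 : ∀ {m n} → Instance m n → (Vec (Subset m) n → ℚ) → ℚ
𝔼 D f = sumℚ (List.map (λ { (p , ts) → p * f ts }) (outcomes D))

-- Maximum matching of the realised bipartite graph: edge (u , v_j) iff
-- u ∈ t_j.  A matching is a map  M : online vertex ↦ Maybe offline vertex
-- using only edges and injective on matched vertices; its size is the number
-- of matched online vertices.

allVecs : ∀ {A : Set} → List A → (n : ℕ) → List (Vec A n)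
allVecs xs zero    = [] ∷ []
allVecs xs (suc n) = concatMap (λ x → List.map (x ∷_) (allVecs xs n)) xs

usesEdges : ∀ {m n} → Vec (Subset m) n → Vec (Maybe (Fin m)) n → Bool
usesEdges []       []             = true
usesEdges (t ∷ ts) (nothing ∷ ms) = usesEdges ts ms
usesEdges (t ∷ ts) (just u ∷ ms)  = lookup t u ∧ usesEdges ts ms

notUsed : ∀ {m k} → Fin m → Vec (Maybe (Fin m)) k → Bool
notUsed u []             = true
notUsed u (nothing ∷ ms) = notUsed u ms
notUsed u (just v ∷ ms)  = if does (u Fin.≟ v) then false else notUsed u ms

injectiveB : ∀ {m k} → Vec (Maybe (Fin m)) k → Bool
injectiveB []             = true
injectiveB (nothing ∷ ms) = injectiveB ms
injectiveB (just u ∷ ms)  = notUsed u ms ∧ injectiveB ms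

isMatching : ∀ {m n} → Vec (Subset m) n → Vec (Maybe (Fin m)) n → Bool
isMatching ts M = usesEdges ts M ∧ injectiveB M

matchingSize : ∀ {m k} → Vec (Maybe (Fin m)) k → ℕ
matchingSize []             = 0
matchingSize (nothing ∷ ms) = matchingSize ms
matchingSize (just _ ∷ ms)  = suc (matchingSize ms)

maxMatching : ∀ {m n} → Vec (Subset m) n → ℕ
maxMatching {m} {n} ts =
  foldr _⊔_ 0 (List.map matchingSize
    (filter (λ M → T? (isMatching ts M)) (allVecs (nothing ∷ List.map just (allFin m)) n)))

𝔼OPT : ∀ {m n} → Instance m n → ℚ
𝔼OPT D = 𝔼 D (λ ts → (+ maxMatching ts) / 1)

-- Given the (known) instance, for each
-- online step j and realisation ts, the algorithm outputs x_{·,j} : Fin m → ℚ.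
-- Non-anticipation: x_{·,j} depends only on t_1 , … , t_j.

Algorithm : Set
Algorithm = ∀ (m n : ℕ) → Instance m n → (j : Fin n) → Vec (Subset m) n → Fin m → ℚ

ValidAlgorithm : Algorithm → Set
ValidAlgorithm A =
  ∀ (m n : ℕ) (D : Instance m n) (j : Fin n) →
    (∀ ts u → 0ℚ ≤ A m n D j ts u)
  × (∀ ts u → u ∉ lookup ts j → A m n D j ts u ≡ 0ℚ)
  × (∀ ts → ∑ (A m n D j ts) ≤ 1ℚ)
  × (∀ ts ts' → (∀ (i : Fin n) → toℕ i ℕ.≤ toℕ j → lookup ts i ≡ lookup ts' i)
              → ∀ u → A m n D j ts u ≡ A m n D j ts' u)

algValue : Algorithm → ∀ {m n} → Instance m n → Vec (Subset m) n → ℚ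
algValue A {m} {n} D ts = ∑ (λ u → ∑ (λ j → A m n D j ts u) ⊓ 1ℚ)

𝔼ALG : Algorithm → ∀ {m n} → Instance m n → ℚ
𝔼ALG A D = 𝔼 D (algValue A D)

-- Competitive ratio of A is at most c:  inf_I E[ALG]/E[OPT] ≤ c, i.e. for
-- every ε > 0 some valid instance has E[ALG] < (c + ε) · E[OPT].
RatioAtMost : Algorithm → ℚ → Set
RatioAtMost A c =
  ∀ (ε : ℚ) → 0ℚ < ε →
    ∃ λ m → ∃ λ n → Σ (Instance m n) λ D →
      ValidInstance D × (𝔼ALG A D < (c + ε) * 𝔼OPT D)

{-# OPTIONS --safe #-}
-- Two offline vertices u₀, u₁; the first online vertex is adjacent to both,
-- the second to exactly one of them, chosen uniformly at random. Both
-- realisations have a perfect matching, so E[OPT] = 2. The first vertex must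
-- split its unit of mass as (a, b) before knowing which offline vertex the
-- second one will need; whichever it is, the other offline vertex collects
-- only its share from the first vertex. Hence E[ALG] ≤ ½(1 + b) + ½(1 + a)
-- ≤ 3/2 = ¾ · E[OPT].
module Submission where

open import Defs
open import Data.Integer using (+_)
open import Data.Rational using (ℚ; 0ℚ; 1ℚ; _+_; _*_; _≤_; _<_; _⊓_; _/_; positive)
open import Data.Rational.Properties
open import Data.Rational.Solver using (module +-*-Solver)
import Data.Nat as ℕ
open import Data.Fin using (Fin; zero; suc; toℕ; opposite)
open import Data.Fin.Subset using (Subset; ⊤; ⁅_⁆; _∉_)
open import Data.Fin.Subset.Properties using (x∈⁅y⁆⇒x≡y)
open import Data.List using ([]; _∷_; [_])
open import Data.List.Relation.Unary.Any using (here; there)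
open import Data.Vec using (Vec; []; _∷_; lookup)
open import Data.Product using (_,_; proj₁; proj₂)
open import Relation.Binary.PropositionalEquality using (_≡_; refl; sym; cong; cong₂; subst; module ≡-Reasoning)
open import Relation.Nullary.Decidable using (toWitness)
open import Data.Unit using (tt)

ratioAtMost-witness : ∀ {A m n} c (D : Instance m n) → ValidInstance D →
                      0ℚ < 𝔼OPT D → 𝔼ALG A D ≤ c * 𝔼OPT D → RatioAtMost A c
ratioAtMost-witness {m = m} {n} c D valid opt>0 alg≤c*opt ε ε>0 =
  m , n , D , valid , ≤-<-trans alg≤c*opt c*opt<[c+ε]*opt
  where
  c<c+ε : c < c + ε
  c<c+ε = subst (_< c + ε) (+-identityʳ c) (+-monoʳ-< c ε>0)

  c*opt<[c+ε]*opt : c * 𝔼OPT D < (c + ε) * 𝔼OPT D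
  c*opt<[c+ε]*opt = *-monoˡ-<-pos (𝔼OPT D) {{positive opt>0}} c<c+ε

∑₂ : (f : Fin 2 → ℚ) → ∑ f ≡ f zero + f (suc zero)
∑₂ f = cong (_+_ (f zero)) (+-identityʳ (f (suc zero)))

min-sum₂≤1+ : ∀ p q → p ⊓ 1ℚ + q ⊓ 1ℚ ≤ 1ℚ + q
min-sum₂≤1+ p q = +-mono-≤ (p⊓q≤q p 1ℚ) (p⊓q≤p q 1ℚ)

opposite∉⁅_⁆ : (u : Fin 2) → opposite u ∉ ⁅ u ⁆
opposite∉⁅ u ⁆ ∈⁅u⁆ with x∈⁅y⁆⇒x≡y u ∈⁅u⁆
opposite∉⁅ zero ⁆     _ | ()
opposite∉⁅ suc zero ⁆ _ | ()

½ : ℚ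
½ = + 1 / 2

hard : Instance 2 2
hard = [ (1ℚ , ⊤) ] ∷ ((½ , ⁅ zero ⁆) ∷ [ (½ , ⁅ suc zero ⁆) ]) ∷ []

hard-valid : ValidInstance hard
hard-valid zero       = (λ { (here refl) → 0≤1 ; (there ()) }) , refl
  where
  0≤1 : 0ℚ ≤ 1ℚ
  0≤1 = toWitness {a? = 0ℚ ≤? 1ℚ} tt
hard-valid (suc zero) = (λ { (here refl) → 0≤½ ; (there (here refl)) → 0≤½ ; (there (there ())) }) , refl
  where
  0≤½ : 0ℚ ≤ ½
  0≤½ = toWitness {a? = 0ℚ ≤? ½} tt

realisation : Fin 2 → Vec (Subset 2) 2
realisation u = ⊤ ∷ ⁅ u ⁆ ∷ []

𝔼-hard : ∀ f → 𝔼 hard f ≡ ½ * f (realisation zero) + (½ * f (realisation (suc zero)) + 0ℚ)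
𝔼-hard f = refl

𝔼OPT-hard : 𝔼OPT hard ≡ + 2 / 1
𝔼OPT-hard = refl

module _ (A : Algorithm) (valid : ValidAlgorithm A) where

  x : Fin 2 → Vec (Subset 2) 2 → Fin 2 → ℚ
  x = A 2 2 hard

  load : Vec (Subset 2) 2 → Fin 2 → ℚ
  load ts u = ∑ (λ j → x j ts u)

  first : Fin 2 → ℚ
  first = x zero (realisation zero)

  ∑-first≤1 : first zero + first (suc zero) ≤ 1ℚ
  ∑-first≤1 = subst (_≤ 1ℚ) (∑₂ first) (proj₁ (proj₂ (proj₂ (valid 2 2 hard zero))) (realisation zero))

  first-nonAnticipating : ∀ w u → x zero (realisation w) u ≡ first u
  first-nonAnticipating w = proj₂ (proj₂ (proj₂ (valid 2 2 hard zero))) (realisation w) (realisation zero) sameFirstType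
    where
    sameFirstType : ∀ (i : Fin 2) → toℕ i ℕ.≤ 0 → lookup (realisation w) i ≡ lookup (realisation zero) i
    sameFirstType zero _ = refl

  algValue≤1+load : ∀ ts u → algValue A hard ts ≤ 1ℚ + load ts (opposite u)
  algValue≤1+load ts zero = begin
    algValue A hard ts                             ≡⟨ ∑₂ (λ u → load ts u ⊓ 1ℚ) ⟩
    load ts zero ⊓ 1ℚ + load ts (suc zero) ⊓ 1ℚ    ≤⟨ min-sum₂≤1+ (load ts zero) (load ts (suc zero)) ⟩
    1ℚ + load ts (suc zero)                        ∎
    where open ≤-Reasoning
  algValue≤1+load ts (suc zero) = begin
    algValue A hard ts                             ≡⟨ ∑₂ (λ u → load ts u ⊓ 1ℚ) ⟩
    load ts zero ⊓ 1ℚ + load ts (suc zero) ⊓ 1ℚ    ≡⟨ +-comm (load ts zero ⊓ 1ℚ) _ ⟩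
    load ts (suc zero) ⊓ 1ℚ + load ts zero ⊓ 1ℚ    ≤⟨ min-sum₂≤1+ (load ts (suc zero)) (load ts zero) ⟩
    1ℚ + load ts zero                              ∎
    where open ≤-Reasoning

  load-unreached : ∀ u → load (realisation u) (opposite u) ≡ first (opposite u)
  load-unreached u = begin
    load (realisation u) (opposite u)                                  ≡⟨ ∑₂ (λ j → x j (realisation u) (opposite u)) ⟩
    x zero (realisation u) (opposite u) + x (suc zero) (realisation u) (opposite u)
      ≡⟨ cong₂ _+_ (first-nonAnticipating u (opposite u)) second-avoids ⟩
    first (opposite u) + 0ℚ                                            ≡⟨ +-identityʳ _ ⟩
    first (opposite u)                                                 ∎
    where
    open ≡-Reasoning
    second-avoids : x (suc zero) (realisation u) (opposite u) ≡ 0ℚ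
    second-avoids = proj₁ (proj₂ (valid 2 2 hard (suc zero))) (realisation u) (opposite u) (opposite∉⁅ u ⁆)

  algValue-realisation≤ : ∀ u → algValue A hard (realisation u) ≤ 1ℚ + first (opposite u)
  algValue-realisation≤ u = subst (λ l → algValue A hard (realisation u) ≤ 1ℚ + l)
                                  (load-unreached u) (algValue≤1+load (realisation u) u)

  𝔼ALG-hard≤ : 𝔼ALG A hard ≤ + 3 / 4 * 𝔼OPT hard
  𝔼ALG-hard≤ = begin
    𝔼ALG A hard                         ≡⟨ 𝔼-hard (algValue A hard) ⟩
    ½ * algValue A hard (realisation zero) + (½ * algValue A hard (realisation (suc zero)) + 0ℚ)
      ≤⟨ +-mono-≤ (*-monoˡ-≤-nonNeg ½ (algValue-realisation≤ zero))
                  (+-monoˡ-≤ 0ℚ (*-monoˡ-≤-nonNeg ½ (algValue-realisation≤ (suc zero)))) ⟩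
    ½ * (1ℚ + b) + (½ * (1ℚ + a) + 0ℚ)  ≡⟨ regroup a b ⟩
    1ℚ + ½ * (a + b)                    ≤⟨ +-monoʳ-≤ 1ℚ (*-monoˡ-≤-nonNeg ½ ∑-first≤1) ⟩
    1ℚ + ½ * 1ℚ                         ≡⟨⟩
    + 3 / 4 * (+ 2 / 1)                 ≡⟨ cong (λ o → + 3 / 4 * o) (sym 𝔼OPT-hard) ⟩
    + 3 / 4 * 𝔼OPT hard                 ∎
    where
    open ≤-Reasoning
    a b : ℚ
    a = first zero
    b = first (suc zero)
    regroup : ∀ a b → ½ * (1ℚ + b) + (½ * (1ℚ + a) + 0ℚ) ≡ 1ℚ + ½ * (a + b)
    regroup = solve 2 (λ a b → con ½ :* (con 1ℚ :+ b) :+ (con ½ :* (con 1ℚ :+ a) :+ con 0ℚ)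
                             := con 1ℚ :+ con ½ :* (a :+ b)) refl
      where open +-*-Solver

theorem5 : (A : Algorithm) → ValidAlgorithm A → RatioAtMost A ((+ 3) / 4)
theorem5 A valid = ratioAtMost-witness (+ 3 / 4) hard hard-valid opt>0 (𝔼ALG-hard≤ A valid)
  where
  opt>0 : 0ℚ < 𝔼OPT hard
  opt>0 = subst (0ℚ <_) (sym 𝔼OPT-hard) (toWitness {a? = 0ℚ <? + 2 / 1} tt)
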